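{- Let $S$ be a triangulated surface with sets of vertices, edges and faces $\mathcal V_0,\mathcal V_1,\mathcal V_2$, and let $\mathcal V=\mathcal V_0\cup\mathcal V_1\cup\mathcal V_2$. Let $\mathcal N=\mathbb Z/12\mathbb Z$. Then any map $T_2:\mathcal V_2\to \operatorname{Multisets}(\mathcal N)$ with $|T_2(\sigma)|=3$ for every $\sigma\in\mathcal V_2$ extends to a simplicial surface tonnetz, i.e. there exists a simplicial surface tonnetz $T:\mathcal V\to\operatorname{Multisets}(\mathcal N)$ on $S$ with $T|_{\mathcal V_2}=T_2$.
   Context: $\operatorname{Multisets}(\mathcal N)$ denotes the set of finite multisets with elements in $\mathcal N$ (sets in which elements may occur with finite multiplicities). For a multiset $\mathcal C$, $|\mathcal C|$ is its order (counted with multiplicity) and $[\mathcal C]$ its underlying set. For a set $\mathcal A$ and a multiset $\mathcal C$, a bijection $\phi:\mathcal A\to\mathcal C$ means a map $\phi:\mathcal A\to[\mathcal C]$ such that for each $c\in[\mathcal C]$ the cardinality of $\phi^{ -1}(c)$ equals the multiplicity of $c$ in $\mathcal C$. The set $\mathcal V$ of simplices of the triangulation is partially ordered by inclusion $\le$ (write $<$ for strict inclusion), and $\tau\prec\sigma$ means $\tau\le\sigma$ with $\tau$ of codimension one in $\sigma$. A simplicial surface tonnetz on $S$ is a map $T:\mathcal V\to\operatorname{Multisets}(\mathcal N)$ such that: (1) (downwards coherent) for every $\sigma\in\mathcal V_1\cup\mathcal V_2$ there exists a bijection $\partial_\sigma:\{\tau\mid\tau\prec\sigma\}\to T(\sigma)$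 such that $\partial_\sigma(\tau)=N$ implies $N\in T(\tau)$; (2) (upwards coherent) for every $\rho\in\mathcal V_0\cup\mathcal V_1$ there exists a bijection $\Delta_\rho:\{\tau\mid\tau\succ\rho\}\to T(\rho)$ such that $\Delta_\rho(\tau)=N$ implies $N\in T(\tau)$. (The bijections are not part of the data; only their existence is required.) -}

module Defs where

open import Data.Nat using (ℕ; zero; suc; _≤_; _≟_)
open import Data.Bool using (Bool; T; _∧_)
open import Data.Fin using (Fin)
open import Data.Fin.Subset using (Subset; _⊆_; ⁅_⁆; _∪_; ∣_∣; Nonempty)
open import Data.Fin.Subset.Properties using (_⊆?_)
open import Data.Vec using (Vec; lookup; sum)
open import Data.Product using (Σ; Σ-syntax; ∃; ∃-syntax; _×_)
open import Data.Sum using (_⊎_)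
open import Function.Bundles using (_↔_)
open import Relation.Nullary using (¬_; ⌊_⌋)
open import Relation.Binary.PropositionalEquality using (_≡_)

HasCard : Set → ℕ → Set
HasCard X m = X ↔ Fin m

-- N = ℤ/12ℤ (only its underlying 12-element set is used).
𝒩 : Set
𝒩 = Fin 12

-- A finite multiset over 𝒩, given by its multiplicity vector.
Multiset : Set
Multiset = Vec ℕ 12

mult : Multiset → 𝒩 → ℕ
mult C c = lookup C c

order : Multiset → ℕ
order C = sum C

_∈ₘ_ : 𝒩 → Multiset → Set
c ∈ₘ C = 1 ≤ mult C c

-- φ : A → C is a bijection onto the multiset C:
-- every fibre φ⁻¹(c) has cardinality equal to the multiplicity of c in C.
IsMultisetBij : (A : Set) → (A → 𝒩) → Multiset → Set
IsMultisetBij A φ C = (c : 𝒩) → HasCard (Σ[ a ∈ A ] φ a ≡ c) (mult C c)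

data Reach {A : Set} (R : A → A → Set) : A → A → Set where
  here  : ∀ {x} → Reach R x x
  there : ∀ {x y z} → R x y → Reach R y z → Reach R x z

-- Triangulated (closed) surfaces as abstract simplicial complexes
-- on the vertex set Fin n.  A simplex is a subset of Fin n; the complex
-- is given by a decidable (Boolean) simplex predicate.

-- τ ≺ σ : τ ⊆ σ and τ has codimension one in σ (Boolean, hence proof-irrelevant)
_≺ᵇ_ : ∀ {n} → Subset n → Subset n → Bool
τ ≺ᵇ σ = ⌊ τ ⊆? σ ⌋ ∧ ⌊ suc ∣ τ ∣ ≟ ∣ σ ∣ ⌋

_≺_ : ∀ {n} → Subset n → Subset n → Set
τ ≺ σ = T (τ ≺ᵇ σ)

record TriangulatedSurface : Set₁ where
  field
    n       : ℕ
    simplex : Subset n → Bool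

  IsSimplex : Subset n → Set
  IsSimplex σ = T (simplex σ)

  InV : ℕ → Subset n → Set
  InV k σ = IsSimplex σ × ∣ σ ∣ ≡ suc k

  InLink : Fin n → Fin n → Set
  InLink v w = InV 1 (⁅ v ⁆ ∪ ⁅ w ⁆)

  LinkAdj : Fin n → Fin n → Fin n → Set
  LinkAdj v w u = InV 2 (⁅ v ⁆ ∪ (⁅ w ⁆ ∪ ⁅ u ⁆))

  field
    simplex-nonempty : ∀ σ → IsSimplex σ → Nonempty σ
    simplex-down     : ∀ σ τ → IsSimplex σ → τ ⊆ σ → Nonempty τ → IsSimplex τ
    vertex-simplex   : ∀ v → IsSimplex ⁅ v ⁆
    dim-≤2           : ∀ σ → IsSimplex σ → ∣ σ ∣ ≤ 3
    pure             : ∀ σ → IsSimplex σ → ∃[ ρ ] (InV 2 ρ × σ ⊆ ρ)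
    edge-two-faces   : ∀ e → InV 1 e →
                       ∃[ ρ₁ ] ∃[ ρ₂ ] (InV 2 ρ₁ × InV 2 ρ₂ × e ⊆ ρ₁ × e ⊆ ρ₂ × ¬ ρ₁ ≡ ρ₂ ×
                         (∀ ρ → InV 2 ρ → e ⊆ ρ → ρ ≡ ρ₁ ⊎ ρ ≡ ρ₂))
    -- the link of every vertex is connected (hence a single cycle)
    link-connected   : ∀ v w u → InLink v w → InLink v u → Reach (LinkAdj v) w u

  Facets : Subset n → Set
  Facets σ = Σ[ τ ∈ Subset n ] (IsSimplex τ × τ ≺ σ)

  Cofacets : Subset n → Set
  Cofacets ρ = Σ[ τ ∈ Subset n ] (IsSimplex τ × ρ ≺ τ)

  -- simplicial surface tonnetz (values of T outside 𝒱 are irrelevant)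
  record IsTonnetz (Tz : Subset n → Multiset) : Set where
    field
      down : ∀ σ → (InV 1 σ ⊎ InV 2 σ) →
             ∃[ ∂ ] (IsMultisetBij (Facets σ) ∂ (Tz σ) ×
                     ((t : Facets σ) → ∂ t ∈ₘ Tz (Data.Product.proj₁ t)))
      up   : ∀ ρ → (InV 0 ρ ⊎ InV 1 ρ) →
             ∃[ Δ ] (IsMultisetBij (Cofacets ρ) Δ (Tz ρ) ×
                     ((t : Cofacets ρ) → Δ t ∈ₘ Tz (Data.Product.proj₁ t)))

{-# OPTIONS --safe #-}

-- Put one note on every incidence τ ≺ σ and use it both as ∂_σ(τ) and as Δ_τ(σ);
-- coherence then only asks that the notes on the facets of σ form T(σ) and the
-- notes on the cofacets of ρ form T(ρ).  Distribute the three notes of T₂(σ) over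
-- the three edges of each face σ.  An edge lies in exactly two faces and has exactly
-- two vertices, so the two notes it receives define T(e) and can be passed down, one
-- to each vertex; T(v) is the multiset of notes a vertex receives from its edges.

module Submission where

open import Defs
open import Data.Fin.Subset using (Subset)
open import Data.Product using (Σ-syntax; ∃-syntax; _×_)
open import Relation.Binary.PropositionalEquality using (_≡_)

open import Axiom.UniquenessOfIdentityProofs using (module Decidable⇒UIP)
open import Data.Bool using (T) renaming (_≟_ to _≟ᵇ_)
open import Data.Bool.Properties using (T-irrelevant; T-∧; T?)
open import Data.Empty using (⊥-elim)
open import Data.Fin using (Fin; zero; suc)
open import Data.Fin.Properties using (+↔⊎; *↔×; 2↔Bool; toℕ<n) renaming (_≟_ to _≟ᶠ_)
open import Data.Fin.Subset using (_⊆_; ∣_∣; Nonempty; inside; outside)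
open import Data.Fin.Subset.Properties
  using (_⊆?_; drop-∷-⊆; out⊆; in⊆in; p⊆q⇒∣p∣≤∣q∣; nonempty?; Empty-unique; ∣⊥∣≡0)
open import Data.Nat as ℕ using (ℕ; _+_; _*_; _≤_; _<_; z≤n; s≤s)
open import Data.Nat.Properties using (suc-injective; ≤-trans; 1+n≰n; m<n⇒n≢0; ≡-irrelevant)
open import Data.Product using (Σ; _,_; proj₁; proj₂; ∃)
open import Data.Product.Algebra using (×-cong)
open import Data.Product.Function.Dependent.Propositional using (Σ-↔)
open import Data.Sum as Sum using (_⊎_; inj₁; inj₂; [_,_]′)
open import Data.Sum.Function.Propositional using (_⊎-↔_)
open import Data.Vec using (Vec; []; _∷_; lookup; tabulate; sum; here)
open import Data.Vec.Properties using (lookup∘tabulate) renaming (≡-dec to ≡-decᵛ)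
open import Function using (_∘_; Inverse; Equivalence)
open import Function.Bundles using (_↔_; mk↔ₛ′)
open import Function.Properties.Inverse using (↔-refl; ↔-sym; ↔-trans)
open import Relation.Nullary using (Dec; yes; no; ¬_; contradiction; ⌊_⌋)
open import Relation.Nullary.Decidable using (_×-dec_; toWitness; fromWitness)
open import Relation.Nullary.Irrelevant using (Irrelevant)
open import Relation.Binary.PropositionalEquality using (refl; sym; trans; cong; cong₂; subst; module ≡-Reasoning)

private
  variable
    A B X : Set
    P : A → Set
    k m : ℕ

×-irrelevant : Irrelevant A → Irrelevant B → Irrelevant (A × B)
×-irrelevant irrA irrB (a , b) (a′ , b′) = cong₂ _,_ (irrA a a′) (irrB b b′)

T×T-irrelevant : ∀ {a b} → Irrelevant (T a × T b)
T×T-irrelevant = ×-irrelevant T-irrelevant T-irrelevant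

Σ-≡-irrelevant : (∀ {a} → Irrelevant (P a)) → {s t : Σ A P} → proj₁ s ≡ proj₁ t → s ≡ t
Σ-≡-irrelevant irr {a , p} {.a , q} refl = cong (a ,_) (irr p q)

Fin-≡-irrelevant : {i j : Fin k} → Irrelevant (i ≡ j)
Fin-≡-irrelevant = Decidable⇒UIP.≡-irrelevant _≟ᶠ_

ifDec : Dec A → (A → X) → X → X
ifDec (yes a) f _ = f a
ifDec (no _)  _ d = d

ifDec-yes : Irrelevant A → (a? : Dec A) (f : A → X) (d : X) (a : A) → ifDec a? f d ≡ f a
ifDec-yes irr (yes a′) f _ a = cong f (irr a′ a)
ifDec-yes irr (no ¬a)  _ _ a = contradiction a ¬a

ifDec-no : (a? : Dec A) (f : A → X) (d : X) → ¬ A → ifDec a? f d ≡ d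
ifDec-no (yes a) _ _ ¬a = contradiction a ¬a
ifDec-no (no _)  _ _ _  = refl

Finite : Set → Set
Finite A = ∃ (HasCard A)

Σ-Fin-suc↔ : (Q : Fin (ℕ.suc k) → Set) → Σ (Fin (ℕ.suc k)) Q ↔ (Q zero ⊎ Σ (Fin k) (Q ∘ suc))
Σ-Fin-suc↔ Q = mk↔ₛ′ to from to∘from from∘to
  where
  to : Σ _ Q → _
  to (zero  , p) = inj₁ p
  to (suc i , p) = inj₂ (i , p)
  from : _ → Σ _ Q
  from (inj₁ p)       = zero , p
  from (inj₂ (i , p)) = suc i , p
  to∘from : ∀ y → to (from y) ≡ y
  to∘from (inj₁ _) = refl
  to∘from (inj₂ _) = refl
  from∘to : ∀ x → from (to x) ≡ x
  from∘to (zero  , _) = refl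
  from∘to (suc _ , _) = refl

Dec∧Irrelevant⇒Finite : Dec A → Irrelevant A → Finite A
Dec∧Irrelevant⇒Finite (yes a) irr = 1 , mk↔ₛ′ (λ _ → zero) (λ _ → a) (λ { zero → refl ; (suc ()) }) (irr a)
Dec∧Irrelevant⇒Finite (no ¬a) _   = 0 , mk↔ₛ′ (⊥-elim ∘ ¬a) (λ ()) (λ ()) (⊥-elim ∘ ¬a)

finite-Σ-Fin : (Q : Fin k → Set) → (∀ i → Dec (Q i)) → (∀ i → Irrelevant (Q i)) → Finite (Σ (Fin k) Q)
finite-Σ-Fin {ℕ.zero}  Q _  _   = 0 , mk↔ₛ′ (λ { (() , _) }) (λ ()) (λ ()) (λ { (() , _) })
finite-Σ-Fin {ℕ.suc k} Q Q? irr =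
  let (a , Q₀↔) = Dec∧Irrelevant⇒Finite (Q? zero) (irr zero)
      (b , Q₊↔) = finite-Σ-Fin (Q ∘ suc) (Q? ∘ suc) (irr ∘ suc)
  in a + b , ↔-trans (Σ-Fin-suc↔ Q) (↔-trans (Q₀↔ ⊎-↔ Q₊↔) (↔-sym +↔⊎))

finite-Σ : Finite A → (∀ a → Dec (P a)) → (∀ a → Irrelevant (P a)) → Finite (Σ A P)
finite-Σ {P = P} (k , A↔) P? irr =
  let (m , Σ↔) = finite-Σ-Fin (P ∘ from) (P? ∘ from) (irr ∘ from)
  in m , ↔-trans (↔-sym (Σ-↔ (↔-sym A↔) ↔-refl)) Σ↔
  where from = Inverse.from A↔

finite-Vec : Finite A → Finite (Vec A m)
finite-Vec {m = ℕ.zero}  _ = 1 , mk↔ₛ′ (λ _ → zero) (λ _ → []) (λ { zero → refl ; (suc ()) }) (λ { [] → refl })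
finite-Vec {m = ℕ.suc m} A-fin@(a , A↔) =
  let (b , V↔) = finite-Vec {m = m} A-fin
  in a * b , ↔-trans ∷↔× (↔-trans (×-cong A↔ V↔) (↔-sym *↔×))
  where
  ∷↔× : Vec _ (ℕ.suc m) ↔ (_ × Vec _ m)
  ∷↔× = mk↔ₛ′ (λ { (x ∷ xs) → x , xs }) (λ (x , xs) → x ∷ xs) (λ _ → refl) (λ { (_ ∷ _) → refl })

finite-Subset : ∀ {n} → Finite (Subset n)
finite-Subset = finite-Vec (2 , ↔-sym 2↔Bool)

fibres-finite : Finite A → (φ : A → 𝒩) (c : 𝒩) → Finite (Σ[ a ∈ A ] φ a ≡ c)
fibres-finite A-fin φ c = finite-Σ A-fin (λ a → φ a ≟ᶠ c) (λ _ → Fin-≡-irrelevant)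

multisetOf : Finite A → (A → 𝒩) → Multiset
multisetOf A-fin φ = tabulate (proj₁ ∘ fibres-finite A-fin φ)

multisetOf-isMultisetBij : (A-fin : Finite A) (φ : A → 𝒩) → IsMultisetBij A φ (multisetOf A-fin φ)
multisetOf-isMultisetBij A-fin φ c
  rewrite lookup∘tabulate (proj₁ ∘ fibres-finite A-fin φ) c = proj₂ (fibres-finite A-fin φ c)

∈ₘ-of-isMultisetBij : {φ : A → 𝒩} {C : Multiset} → IsMultisetBij A φ C → (a : A) → φ a ∈ₘ C
∈ₘ-of-isMultisetBij {φ = φ} bij a = ≤-trans (s≤s z≤n) (toℕ<n (Inverse.to (bij (φ a)) (a , refl)))

IsMultisetBij-transport : {φ : B → 𝒩} {ψ : A → 𝒩} {C : Multiset} (e : A ↔ B) →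
                          (∀ a → ψ a ≡ φ (Inverse.to e a)) →
                          IsMultisetBij B φ C → IsMultisetBij A ψ C
IsMultisetBij-transport {φ = φ} {ψ} e ψ≗φ∘e bij c = ↔-trans (Σ-↔ e fibre↔) (bij c)
  where
  fibre↔ : ∀ {a} → (ψ a ≡ c) ↔ (φ (Inverse.to e a) ≡ c)
  fibre↔ {a} = mk↔ₛ′ (trans (sym (ψ≗φ∘e a))) (trans (ψ≗φ∘e a))
                     (λ _ → Fin-≡-irrelevant _ _) (λ _ → Fin-≡-irrelevant _ _)

Fin-sum↔Σ : (C : Vec ℕ m) → Fin (sum C) ↔ (Σ[ i ∈ Fin m ] Fin (lookup C i))
Fin-sum↔Σ []      = mk↔ₛ′ (λ ()) (λ { (() , _) }) (λ { (() , _) }) (λ ())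
Fin-sum↔Σ (k ∷ C) = ↔-trans +↔⊎ (↔-trans (↔-refl ⊎-↔ Fin-sum↔Σ C) (↔-sym (Σ-Fin-suc↔ _)))

proj₁-isMultisetBij : (C : Multiset) → IsMultisetBij (Σ[ c ∈ 𝒩 ] Fin (mult C c)) proj₁ C
proj₁-isMultisetBij C c = mk↔ₛ′ (λ { ((_ , i) , refl) → i }) (λ i → (c , i) , refl)
                                (λ _ → refl) (λ { ((_ , i) , refl) → refl })

HasCard-order⇒∃-IsMultisetBij : (C : Multiset) → HasCard A (order C) → ∃[ φ ] IsMultisetBij A φ C
HasCard-order⇒∃-IsMultisetBij C A↔ =
  _ , IsMultisetBij-transport {C = C} (↔-trans A↔ (Fin-sum↔Σ C)) (λ _ → refl) (proj₁-isMultisetBij C)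

≺⇒⊆×∣∣ : ∀ {n} (τ σ : Subset n) → τ ≺ σ → τ ⊆ σ × ℕ.suc ∣ τ ∣ ≡ ∣ σ ∣
≺⇒⊆×∣∣ τ σ τ≺σ =
  let (⊆ᵇ , ∣∣ᵇ) = Equivalence.to (T-∧ {⌊ τ ⊆? σ ⌋}) τ≺σ in toWitness ⊆ᵇ , toWitness ∣∣ᵇ

⊆×∣∣⇒≺ : ∀ {n} {τ σ : Subset n} → τ ⊆ σ → ℕ.suc ∣ τ ∣ ≡ ∣ σ ∣ → τ ≺ σ
⊆×∣∣⇒≺ {τ = τ} {σ} τ⊆σ ∣τ∣ =
  Equivalence.from (T-∧ {⌊ τ ⊆? σ ⌋}) (fromWitness (λ {x} → τ⊆σ {x}) , fromWitness ∣τ∣)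

removeAt : ∀ {n} (σ : Subset n) → Fin ∣ σ ∣ → Subset n
removeAt (outside ∷ σ) i       = outside ∷ removeAt σ i
removeAt (inside  ∷ σ) zero    = outside ∷ σ
removeAt (inside  ∷ σ) (suc i) = inside ∷ removeAt σ i

removeAt-⊆ : ∀ {n} (σ : Subset n) i → removeAt σ i ⊆ σ
removeAt-⊆ (outside ∷ σ) i       = out⊆ (removeAt-⊆ σ i)
removeAt-⊆ (inside  ∷ σ) zero    = out⊆ (λ x∈σ → x∈σ)
removeAt-⊆ (inside  ∷ σ) (suc i) = in⊆in (removeAt-⊆ σ i)

∣removeAt∣ : ∀ {n} (σ : Subset n) i → ℕ.suc ∣ removeAt σ i ∣ ≡ ∣ σ ∣
∣removeAt∣ (outside ∷ σ) i       = ∣removeAt∣ σ i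
∣removeAt∣ (inside  ∷ σ) zero    = refl
∣removeAt∣ (inside  ∷ σ) (suc i) = cong ℕ.suc (∣removeAt∣ σ i)

removedIndex : ∀ {n} (σ τ : Subset n) → τ ⊆ σ → ℕ.suc ∣ τ ∣ ≡ ∣ σ ∣ → Fin ∣ σ ∣
removedIndex []            []            _    ()
removedIndex (outside ∷ σ) (outside ∷ τ) τ⊆σ ∣τ∣ = removedIndex σ τ (drop-∷-⊆ τ⊆σ) ∣τ∣
removedIndex (outside ∷ σ) (inside  ∷ τ) τ⊆σ _   = contradiction (τ⊆σ here) λ ()
removedIndex (inside  ∷ σ) (outside ∷ τ) _    _   = zero
removedIndex (inside  ∷ σ) (inside  ∷ τ) τ⊆σ ∣τ∣ =
  suc (removedIndex σ τ (drop-∷-⊆ τ⊆σ) (suc-injective ∣τ∣))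

p⊆q∧∣p∣≡∣q∣⇒p≡q : ∀ {n} {p q : Subset n} → p ⊆ q → ∣ p ∣ ≡ ∣ q ∣ → p ≡ q
p⊆q∧∣p∣≡∣q∣⇒p≡q {p = []}          {[]}          _   _     = refl
p⊆q∧∣p∣≡∣q∣⇒p≡q {p = outside ∷ p} {outside ∷ q} p⊆q ∣p∣ =
  cong (outside ∷_) (p⊆q∧∣p∣≡∣q∣⇒p≡q (drop-∷-⊆ p⊆q) ∣p∣)
p⊆q∧∣p∣≡∣q∣⇒p≡q {p = outside ∷ p} {inside  ∷ q} p⊆q ∣p∣ =
  contradiction (subst (_≤ ∣ q ∣) ∣p∣ (p⊆q⇒∣p∣≤∣q∣ (drop-∷-⊆ p⊆q))) 1+n≰n
p⊆q∧∣p∣≡∣q∣⇒p≡q {p = inside  ∷ p} {outside ∷ q} p⊆q _   = contradiction (p⊆q here) λ ()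
p⊆q∧∣p∣≡∣q∣⇒p≡q {p = inside  ∷ p} {inside  ∷ q} p⊆q ∣p∣ =
  cong (inside ∷_) (p⊆q∧∣p∣≡∣q∣⇒p≡q (drop-∷-⊆ p⊆q) (suc-injective ∣p∣))

removeAt-removedIndex : ∀ {n} (σ τ : Subset n) (τ⊆σ : τ ⊆ σ) (∣τ∣ : ℕ.suc ∣ τ ∣ ≡ ∣ σ ∣) →
                        removeAt σ (removedIndex σ τ τ⊆σ ∣τ∣) ≡ τ
removeAt-removedIndex []            []            _   ()
removeAt-removedIndex (outside ∷ σ) (outside ∷ τ) τ⊆σ ∣τ∣ =
  cong (outside ∷_) (removeAt-removedIndex σ τ (drop-∷-⊆ τ⊆σ) ∣τ∣)
removeAt-removedIndex (outside ∷ σ) (inside  ∷ τ) τ⊆σ _   = contradiction (τ⊆σ here) λ ()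
removeAt-removedIndex (inside  ∷ σ) (outside ∷ τ) τ⊆σ ∣τ∣ =
  cong (outside ∷_) (sym (p⊆q∧∣p∣≡∣q∣⇒p≡q (drop-∷-⊆ τ⊆σ) (suc-injective ∣τ∣)))
removeAt-removedIndex (inside  ∷ σ) (inside  ∷ τ) τ⊆σ ∣τ∣ =
  cong (inside ∷_) (removeAt-removedIndex σ τ (drop-∷-⊆ τ⊆σ) (suc-injective ∣τ∣))

removedIndex-removeAt : ∀ {n} (σ : Subset n) i
                        (τ⊆σ : removeAt σ i ⊆ σ) (∣τ∣ : ℕ.suc ∣ removeAt σ i ∣ ≡ ∣ σ ∣) →
                        removedIndex σ (removeAt σ i) τ⊆σ ∣τ∣ ≡ i
removedIndex-removeAt (outside ∷ σ) i       τ⊆σ ∣τ∣ = removedIndex-removeAt σ i (drop-∷-⊆ τ⊆σ) ∣τ∣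
removedIndex-removeAt (inside  ∷ σ) zero    _   _   = refl
removedIndex-removeAt (inside  ∷ σ) (suc i) τ⊆σ ∣τ∣ =
  cong suc (removedIndex-removeAt σ i (drop-∷-⊆ τ⊆σ) (suc-injective ∣τ∣))

codimOne↔Fin : ∀ {n} (σ : Subset n) → (Σ[ τ ∈ Subset n ] τ ≺ σ) ↔ Fin ∣ σ ∣
codimOne↔Fin σ = mk↔ₛ′ to from to∘from from∘to
  where
  to : Σ[ τ ∈ _ ] τ ≺ σ → Fin ∣ σ ∣
  to (τ , τ≺σ) = let (τ⊆σ , ∣τ∣) = ≺⇒⊆×∣∣ τ σ τ≺σ in removedIndex σ τ τ⊆σ ∣τ∣
  from : Fin ∣ σ ∣ → Σ[ τ ∈ _ ] τ ≺ σ
  from i = removeAt σ i , ⊆×∣∣⇒≺ (removeAt-⊆ σ i) (∣removeAt∣ σ i)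
  to∘from : ∀ i → to (from i) ≡ i
  to∘from i = removedIndex-removeAt σ i _ _
  from∘to : ∀ t → from (to t) ≡ t
  from∘to (τ , τ≺σ) = Σ-≡-irrelevant T-irrelevant (removeAt-removedIndex σ τ _ _)

∣p∣>0⇒Nonempty : ∀ {n} {p : Subset n} → 0 < ∣ p ∣ → Nonempty p
∣p∣>0⇒Nonempty {n} {p} 0<∣p∣ with nonempty? p
... | yes p≠∅ = p≠∅
... | no  p=∅ = contradiction (trans (cong ∣_∣ (Empty-unique p=∅)) (∣⊥∣≡0 n)) (m<n⇒n≢0 0<∣p∣)

module Surface (S : TriangulatedSurface) where
  open TriangulatedSurface S

  InV? : ∀ k σ → Dec (InV k σ)
  InV? k σ = T? (simplex σ) ×-dec (∣ σ ∣ ℕ.≟ ℕ.suc k)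

  InV-irrelevant : ∀ {k σ} → Irrelevant (InV k σ)
  InV-irrelevant = ×-irrelevant T-irrelevant ≡-irrelevant

  InV-unique : ∀ {k m σ} → InV k σ → InV m σ → k ≡ m
  InV-unique (_ , ∣σ∣) (_ , ∣σ∣′) = suc-injective (trans (sym ∣σ∣) ∣σ∣′)

  ≺-InV : ∀ {k} σ τ → IsSimplex τ → τ ≺ σ → InV (ℕ.suc k) σ → InV k τ
  ≺-InV σ τ sτ τ≺σ (_ , ∣σ∣) = sτ , suc-injective (trans (proj₂ (≺⇒⊆×∣∣ τ σ τ≺σ)) ∣σ∣)

  ≻-InV : ∀ {k} σ τ → IsSimplex σ → τ ≺ σ → InV k τ → InV (ℕ.suc k) σ
  ≻-InV σ τ sσ τ≺σ (_ , ∣τ∣) = sσ , trans (sym (proj₂ (≺⇒⊆×∣∣ τ σ τ≺σ))) (cong ℕ.suc ∣τ∣)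

  facets↔Fin : ∀ {k} σ → IsSimplex σ → ∣ σ ∣ ≡ ℕ.suc (ℕ.suc k) → HasCard (Facets σ) (ℕ.suc (ℕ.suc k))
  facets↔Fin {k} σ sσ ∣σ∣ = subst (HasCard (Facets σ)) ∣σ∣ (↔-trans forget-simplex (codimOne↔Fin σ))
    where
    facet-simplex : ∀ {τ} → τ ≺ σ → IsSimplex τ
    facet-simplex {τ} τ≺σ =
      let (τ⊆σ , ∣τ∣) = ≺⇒⊆×∣∣ τ σ τ≺σ
          0<∣τ∣       = subst (0 <_) (sym (suc-injective (trans ∣τ∣ ∣σ∣))) (s≤s z≤n)
      in simplex-down σ τ sσ τ⊆σ (∣p∣>0⇒Nonempty 0<∣τ∣)
    forget-simplex : Facets σ ↔ (Σ[ τ ∈ Subset n ] τ ≺ σ)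
    forget-simplex = mk↔ₛ′ (λ (τ , _ , τ≺σ) → τ , τ≺σ) (λ (τ , τ≺σ) → τ , facet-simplex τ≺σ , τ≺σ)
                           (λ _ → refl) (λ _ → Σ-≡-irrelevant T×T-irrelevant refl)

  cofacets-finite : ∀ σ → Finite (Cofacets σ)
  cofacets-finite σ = finite-Σ finite-Subset (λ τ → T? (simplex τ) ×-dec T? (σ ≺ᵇ τ)) (λ _ → T×T-irrelevant)

  edge-cofacets↔Fin2Fin : ∀ e → InV 1 e → HasCard (Cofacets e) 2
  edge-cofacets↔Fin2Fin e he@(_ , ∣e∣) with edge-two-faces e he
  ... | ρ₁ , ρ₂ , f₁ , f₂ , e⊆ρ₁ , e⊆ρ₂ , ρ₁≢ρ₂ , only-ρ₁ρ₂ = mk↔ₛ′ to from to∘from from∘to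
    where
    _≟ˢ_ : (ρ ρ′ : Subset n) → Dec (ρ ≡ ρ′)
    _≟ˢ_ = ≡-decᵛ _≟ᵇ_
    cofacet : ∀ {ρ} → InV 2 ρ → e ⊆ ρ → Cofacets e
    cofacet {ρ} (sρ , ∣ρ∣) e⊆ρ = ρ , sρ , ⊆×∣∣⇒≺ e⊆ρ (trans (cong ℕ.suc ∣e∣) (sym ∣ρ∣))
    to : Cofacets e → Fin 2
    to (ρ , _) with ρ ≟ˢ ρ₁
    ... | yes _ = zero
    ... | no  _ = suc zero
    from : Fin 2 → Cofacets e
    from zero       = cofacet f₁ e⊆ρ₁
    from (suc zero) = cofacet f₂ e⊆ρ₂
    to∘from : ∀ i → to (from i) ≡ i
    to∘from zero with ρ₁ ≟ˢ ρ₁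
    ... | yes _    = refl
    ... | no ρ₁≢ρ₁ = contradiction refl ρ₁≢ρ₁
    to∘from (suc zero) with ρ₂ ≟ˢ ρ₁
    ... | yes ρ₂≡ρ₁ = contradiction (sym ρ₂≡ρ₁) ρ₁≢ρ₂
    ... | no _      = refl
    from∘to : ∀ t → from (to t) ≡ t
    from∘to (ρ , sρ , e≺ρ) with ρ ≟ˢ ρ₁ | only-ρ₁ρ₂ ρ (≻-InV ρ e sρ e≺ρ he) (proj₁ (≺⇒⊆×∣∣ e ρ e≺ρ))
    ... | yes ρ≡ρ₁ | _        = Σ-≡-irrelevant T×T-irrelevant (sym ρ≡ρ₁)
    ... | no ρ≢ρ₁  | inj₁ ρ≡ρ₁ = contradiction ρ≡ρ₁ ρ≢ρ₁
    ... | no _     | inj₂ ρ≡ρ₂ = Σ-≡-irrelevant T×T-irrelevant (sym ρ≡ρ₂)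

  edge-facets↔Fincofacets : ∀ e → InV 1 e → Facets e ↔ Cofacets e
  edge-facets↔Fincofacets e he@(se , ∣e∣) = ↔-trans (facets↔Fin e se ∣e∣) (↔-sym (edge-cofacets↔Fin2Fin e he))

  isFacet? : ∀ σ τ → Dec (IsSimplex τ × τ ≺ σ)
  isFacet? σ τ = T? (simplex τ) ×-dec T? (τ ≺ᵇ σ)

  onFacets : ∀ σ → (Facets σ → 𝒩) → Subset n → 𝒩
  onFacets σ f τ = ifDec (isFacet? σ τ) (λ τ∈ → f (τ , τ∈)) zero

  onFacets-≡ : ∀ σ (f : Facets σ → 𝒩) (t : Facets σ) → onFacets σ f (proj₁ t) ≡ f t
  onFacets-≡ σ f (τ , τ∈) = ifDec-yes T×T-irrelevant (isFacet? σ τ) (λ τ∈ → f (τ , τ∈)) zero τ∈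

  isTonnetz-fromNotes : (Tz : Subset n → Multiset) (note : Subset n → Subset n → 𝒩) →
    (∀ σ → InV 1 σ ⊎ InV 2 σ → IsMultisetBij (Facets σ) (λ t → note σ (proj₁ t)) (Tz σ)) →
    (∀ ρ → InV 0 ρ ⊎ InV 1 ρ → IsMultisetBij (Cofacets ρ) (λ t → note (proj₁ t) ρ) (Tz ρ)) →
    IsTonnetz Tz
  isTonnetz-fromNotes Tz note facets-bij cofacets-bij = record
    { down = λ σ hσ → _ , facets-bij σ hσ , λ (τ , sτ , τ≺σ) →
        ∈ₘ-of-isMultisetBij {C = Tz τ} (cofacets-bij τ (below σ τ sτ τ≺σ hσ)) (σ , simplexOf hσ , τ≺σ)
    ; up   = λ ρ hρ → _ , cofacets-bij ρ hρ , λ (τ , sτ , ρ≺τ) →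
        ∈ₘ-of-isMultisetBij {C = Tz τ} (facets-bij τ (above τ ρ sτ ρ≺τ hρ)) (ρ , simplexOf hρ , ρ≺τ)
    }
    where
    simplexOf : ∀ {σ k m} → InV k σ ⊎ InV m σ → IsSimplex σ
    simplexOf = [ proj₁ , proj₁ ]′
    below : ∀ σ τ → IsSimplex τ → τ ≺ σ → InV 1 σ ⊎ InV 2 σ → InV 0 τ ⊎ InV 1 τ
    below σ τ sτ τ≺σ = Sum.map (≺-InV σ τ sτ τ≺σ) (≺-InV σ τ sτ τ≺σ)
    above : ∀ σ τ → IsSimplex σ → τ ≺ σ → InV 0 τ ⊎ InV 1 τ → InV 1 σ ⊎ InV 2 σ
    above σ τ sσ τ≺σ = Sum.map (≻-InV σ τ sσ τ≺σ) (≻-InV σ τ sσ τ≺σ)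

module Extension (S : TriangulatedSurface) (T₂ : Subset (TriangulatedSurface.n S) → Multiset)
                 (order-T₂ : ∀ σ → TriangulatedSurface.InV S 2 σ → order (T₂ σ) ≡ 3) where
  open TriangulatedSurface S
  open Surface S

  faceEnumeration : ∀ σ → InV 2 σ → ∃[ φ ] IsMultisetBij (Facets σ) φ (T₂ σ)
  faceEnumeration σ hσ@(sσ , ∣σ∣) =
    HasCard-order⇒∃-IsMultisetBij (T₂ σ) (subst (HasCard (Facets σ)) (sym (order-T₂ σ hσ)) (facets↔Fin σ sσ ∣σ∣))

  faceNote : ∀ σ → InV 2 σ → Facets σ → 𝒩
  faceNote σ hσ = proj₁ (faceEnumeration σ hσ)

  noteFromFace : ∀ e → InV 1 e → Cofacets e → 𝒩
  noteFromFace e he (ρ , sρ , e≺ρ) = onFacets ρ (faceNote ρ (≻-InV ρ e sρ e≺ρ he)) e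

  edgeNote : ∀ e → Facets e → 𝒩
  edgeNote e t = ifDec (InV? 1 e) (λ he → noteFromFace e he (Inverse.to (edge-facets↔Fincofacets e he) t)) zero

  -- The note on the incidence τ ≺ σ (zero when τ ≺ σ is not an incidence below an edge or face).
  note : Subset n → Subset n → 𝒩
  note σ τ = ifDec (InV? 2 σ) (λ hσ → onFacets σ (faceNote σ hσ) τ) (onFacets σ (edgeNote σ) τ)

  Tz : Subset n → Multiset
  Tz σ = ifDec (InV? 2 σ) (λ _ → T₂ σ) (multisetOf (cofacets-finite σ) (λ t → note (proj₁ t) σ))

  note-face : ∀ σ (hσ : InV 2 σ) τ → note σ τ ≡ onFacets σ (faceNote σ hσ) τ
  note-face σ hσ τ = ifDec-yes InV-irrelevant (InV? 2 σ) (λ hσ → onFacets σ (faceNote σ hσ) τ) _ hσ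

  note-nonface : ∀ σ → ¬ InV 2 σ → ∀ τ → note σ τ ≡ onFacets σ (edgeNote σ) τ
  note-nonface σ ¬hσ τ = ifDec-no (InV? 2 σ) (λ hσ → onFacets σ (faceNote σ hσ) τ) _ ¬hσ

  edgeNote-≡ : ∀ e (he : InV 1 e) (t : Facets e) →
               edgeNote e t ≡ noteFromFace e he (Inverse.to (edge-facets↔Fincofacets e he) t)
  edgeNote-≡ e he t =
    ifDec-yes InV-irrelevant (InV? 1 e) (λ he → noteFromFace e he (Inverse.to (edge-facets↔Fincofacets e he) t)) zero he

  noteFromFace-≡ : ∀ e (he : InV 1 e) (t : Cofacets e) → note (proj₁ t) e ≡ noteFromFace e he t
  noteFromFace-≡ e he (ρ , sρ , e≺ρ) = note-face ρ (≻-InV ρ e sρ e≺ρ he) e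

  nonface : ∀ σ → InV 0 σ ⊎ InV 1 σ → ¬ InV 2 σ
  nonface _ (inj₁ hv) hf = contradiction (InV-unique hv hf) λ ()
  nonface _ (inj₂ he) hf = contradiction (InV-unique he hf) λ ()

  Tz-face : ∀ σ → InV 2 σ → Tz σ ≡ T₂ σ
  Tz-face σ = ifDec-yes InV-irrelevant (InV? 2 σ) (λ _ → T₂ σ) _

  Tz-nonface : ∀ σ → ¬ InV 2 σ → Tz σ ≡ multisetOf (cofacets-finite σ) (λ t → note (proj₁ t) σ)
  Tz-nonface σ = ifDec-no (InV? 2 σ) (λ _ → T₂ σ) _

  cofacets-isMultisetBij : ∀ ρ → InV 0 ρ ⊎ InV 1 ρ → IsMultisetBij (Cofacets ρ) (λ t → note (proj₁ t) ρ) (Tz ρ)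
  cofacets-isMultisetBij ρ hρ =
    subst (IsMultisetBij (Cofacets ρ) (λ t → note (proj₁ t) ρ)) (sym (Tz-nonface ρ (nonface ρ hρ)))
          (multisetOf-isMultisetBij (cofacets-finite ρ) (λ t → note (proj₁ t) ρ))

  facets-isMultisetBij : ∀ σ → InV 1 σ ⊎ InV 2 σ → IsMultisetBij (Facets σ) (λ t → note σ (proj₁ t)) (Tz σ)
  facets-isMultisetBij σ (inj₂ hσ) =
    subst (IsMultisetBij (Facets σ) (λ t → note σ (proj₁ t))) (sym (Tz-face σ hσ))
          (IsMultisetBij-transport {φ = faceNote σ hσ} {C = T₂ σ} (↔-refl {A = Facets σ}) note≡
                                   (proj₂ (faceEnumeration σ hσ)))
    where
    note≡ : ∀ t → note σ (proj₁ t) ≡ faceNote σ hσ t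
    note≡ t = trans (note-face σ hσ (proj₁ t)) (onFacets-≡ σ (faceNote σ hσ) t)
  facets-isMultisetBij e (inj₁ he) =
    IsMultisetBij-transport {φ = λ t → note (proj₁ t) e} {ψ = λ t → note e (proj₁ t)} {C = Tz e}
                            pairing note≡ (cofacets-isMultisetBij e (inj₂ he))
    where
    pairing : Facets e ↔ Cofacets e
    pairing = edge-facets↔Fincofacets e he
    open ≡-Reasoning
    note≡ : (t : Facets e) → note e (proj₁ t) ≡ note (proj₁ (Inverse.to pairing t)) e
    note≡ t = begin
      note e (proj₁ t)                          ≡⟨ note-nonface e (nonface e (inj₂ he)) (proj₁ t) ⟩
      onFacets e (edgeNote e) (proj₁ t)         ≡⟨ onFacets-≡ e (edgeNote e) t ⟩
      edgeNote e t                              ≡⟨ edgeNote-≡ e he t ⟩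
      noteFromFace e he (Inverse.to pairing t)  ≡⟨ noteFromFace-≡ e he (Inverse.to pairing t) ⟨
      note (proj₁ (Inverse.to pairing t)) e     ∎

lemma2p3 : (S : TriangulatedSurface) → let open TriangulatedSurface S in
    (T₂ : Subset n → Multiset) →
    (∀ σ → InV 2 σ → order (T₂ σ) ≡ 3) →
    ∃[ Tz ] (IsTonnetz Tz × (∀ σ → InV 2 σ → Tz σ ≡ T₂ σ))
lemma2p3 S T₂ order-T₂ =
  Tz , Surface.isTonnetz-fromNotes S Tz note facets-isMultisetBij cofacets-isMultisetBij , Tz-face
  where open Extension S T₂ order-T₂
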